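{- For any nonnegative integer $k$ and any $d\ge0$, $\Psi_k(\mathrm{APS}_d(m,n))$ equals the set of $Q\in\mathrm{APS}_d(m+k,n)$ such that every element of $Q$ has the form $\zeta^{b}(x)$ with $b\ge k$; i.e. $\Psi_k(\mathrm{APS}_d(m,n))=\mathrm{APS}_d(m+k,n)\cap\mathcal{P}(\mathbb{I}_n^{m+k}\setminus\mathbb{I}_n^{k})$, where $\mathbb{I}_n^k$ is identified with $\bigcup_{b=0}^{k-1}\zeta^b[n]\subseteq\mathbb{I}_n^{m+k}$.
   Context: For positive integers $M,n$, $[n]=\{1,\dots,n\}$, $\eta=e^{2\pi i/M}$; $\eta^a(x)$ denotes $\eta^a\cdot x$ ($0\le a\le M-1$), $\eta^a[n]=\{\eta^a(1),\dots,\eta^a(n)\}$, $\mathbb{I}_n^M=\bigcup_{a=0}^{M-1}\eta^a[n]$, totally ordered by $\eta^a(x)\prec\eta^b(y)$ iff $a>b$, or $a=b$ and $x>y$. $\mathbb{Z}_M\wr S_n$ is the group of bijections $w$ of $\mathbb{I}_n^M$ with $w(\eta^i x)=\eta^i w(x)$ for $x\in[n]$, all $i$, written $w(n)\cdots w(1)$. $\operatorname{Pin}(w)=\{w(i):2\le i\le n-1,\ w(i+1)\prec w(i)\succ w(i-1)\}$. $\mathrm{APS}_d(M,n)$ is the collection of sets $\operatorname{Pin}(w)$, $w\in\mathbb{Z}_M\wr S_n$, of cardinality at most $d$; $\mathcal{P}$ denotes power set. Fix $m\ge1$, $\xi=e^{2\pi i/m}$, $\zeta=e^{2\pi i/(m+k)}$;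 $\Psi_k$ sends $\{\xi^{a_j}(x_j)\}\subseteq\mathbb{I}_n^m$ to $\{\zeta^{a_j+k}(x_j)\}\subseteq\mathbb{I}_n^{m+k}$. -}

module Defs where

open import Data.Nat using (ℕ; zero; suc; _+_; _∸_; _≤_; _<_; _≤?_)
open import Data.Nat.Properties using (m∸n+n≡m; +-cancelʳ-<)
open import Data.Fin using (Fin; toℕ; fromℕ<)
open import Data.Fin.Permutation using (Permutation′; _⟨$⟩ʳ_)
open import Data.Product using (Σ; ∃; _×_; _,_)
open import Data.Sum using (_⊎_)
open import Data.Bool using (Bool; true; false; if_then_else_)
open import Data.List using (List; map; allFin)
open import Data.Nat.ListAction using (sum)
open import Data.Fin.Properties using (toℕ<n)
open import Relation.Binary.PropositionalEquality using (_≡_; subst; sym)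
open import Relation.Nullary using (yes; no)

-- Elements of 𝕀ₙᴹ : the pair (a , x) stands for η^a(x+1), a ∈ {0..M-1}, x+1 ∈ [n].
Elem : ℕ → ℕ → Set
Elem M n = Fin M × Fin n

_≺_ : ∀ {M n} → Elem M n → Elem M n → Set
(a , x) ≺ (b , y) = (toℕ b < toℕ a) ⊎ ((a ≡ b) × (toℕ y < toℕ x))

-- An element of ℤ_M ≀ S_n: the bijection w of 𝕀ₙᴹ is determined by its values on [n],
-- w(x+1) = η^(colour x)(σ(x)+1), with σ a permutation of [n]; w(η^i y) = η^i w(y).
record Wreath (M n : ℕ) : Set where
  constructor wreath
  field
    perm   : Permutation′ n
    colour : Fin n → Fin M

-- w(i+1) for 0-indexed position i : Fin n
app : ∀ {M n} → Wreath M n → Fin n → Elem M n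
app (wreath σ c) i = (c i , σ ⟨$⟩ʳ i)

SubsetI : ℕ → ℕ → Set
SubsetI M n = Elem M n → Bool

_∈ˢ_ : ∀ {M n} → Elem M n → SubsetI M n → Set
p ∈ˢ Q = Q p ≡ true

_≐_ : ∀ {M n} → SubsetI M n → SubsetI M n → Set
Q ≐ R = ∀ p → Q p ≡ R p

card : ∀ {M n} → SubsetI M n → ℕ
card {M} {n} Q = sum (map (λ a → sum (map (λ x → if Q (a , x) then 1 else 0) (allFin n))) (allFin M))

-- p ∈ Pin(w): p = w(i) for some 2 ≤ i ≤ n-1 with w(i+1) ≺ w(i) ≻ w(i-1)
-- (positions are 0-indexed here: i⁻ , i , i⁺ are consecutive).
InPin : ∀ {M n} → Wreath M n → Elem M n → Set
InPin {M} {n} w p =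
  Σ (Fin n) λ i⁻ → Σ (Fin n) λ i → Σ (Fin n) λ i⁺ →
    (suc (toℕ i⁻) ≡ toℕ i) × (suc (toℕ i) ≡ toℕ i⁺) ×
    (p ≡ app w i) × (app w i⁺ ≺ app w i) × (app w i⁻ ≺ app w i)

InAPS : (d M n : ℕ) → SubsetI M n → Set
InAPS d M n Q =
  (Σ (Wreath M n) λ w → ∀ p → (p ∈ˢ Q → InPin w p) × (InPin w p → p ∈ˢ Q))
  × (card Q ≤ d)

private
  shiftLemma : ∀ {m k b} → b < m + k → k ≤ b → b ∸ k < m
  shiftLemma {m} {k} {b} lt k≤b =
    +-cancelʳ-< k (b ∸ k) m (subst (_< m + k) (sym (m∸n+n≡m k≤b)) lt)

-- Ψ_k : ξ^a(x) ↦ ζ^(a+k)(x), extended to subsets (image of a set).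
-- (Ψ k Q) contains ζ^b(x) iff b ≥ k and ξ^(b-k)(x) ∈ Q.
Ψ : ∀ {m n} (k : ℕ) → SubsetI m n → SubsetI (m + k) n
Ψ {m} k Q (b , x) with k ≤? toℕ b
... | no _ = false
... | yes k≤b = Q (fromℕ< (shiftLemma {m} {k} (toℕ<n b) k≤b) , x)

-- Ψ_k raises every colour by k; this is an order embedding of 𝕀ₙᵐ onto the letters of
-- 𝕀ₙᵐ⁺ᵏ of colour ≥ k, so it carries Pin(w) to the pinnacle set of w with all colours raised,
-- and it preserves cardinality. Conversely, let Pin(w) use only colours ≥ k. Letters of colour < k
-- ("low" letters) lie above all others, so a maximal letter of w is low, hence not a pinnacle, hence
-- it sits at an end of w; after reversing, it is the first letter. Recolour that letter to colour k and
-- move it just past the initial descending run of letters lying above it: the pinnacle set does not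
-- change and there is one low letter fewer. Iterating, we reach a w″ with the same pinnacle set and
-- no low letters, and lowering its colours by k gives a preimage under Ψ_k.

module Submission where

open import Defs
open import Data.Bool using (Bool; true; false; if_then_else_)
open import Data.Bool.Properties using (¬-not)
open import Data.Empty using (⊥-elim)
open import Data.Fin using (Fin; zero; suc; toℕ; fromℕ; fromℕ<; opposite; inject₁)
open import Data.Fin.Permutation
  using (Permutation′; _⟨$⟩ʳ_; _⟨$⟩ˡ_; inverseˡ; inverseʳ; _∘ₚ_; lift₀; transpose)
import Data.Fin.Permutation as Perm
open import Data.Fin.Properties
  using (any?; toℕ-injective; toℕ<n; toℕ-fromℕ<; toℕ-inject₁; opposite-prop; opposite-involutive)
import Data.Fin.Properties as Fin
open import Data.Fin.Subset using (Subset; _∈_; _⊂_)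
open import Data.Fin.Subset.Induction using (⊂-wellFounded)
open import Data.List using (List; []; _∷_; map; tabulate; allFin)
import Data.List.Extrema as Extrema
open import Data.List.Membership.Propositional.Properties using (∈-allFin)
open import Data.List.Properties using (map-cong; map-tabulate; tabulate-cong)
import Data.List.Relation.Unary.All as All
open import Data.Nat using (ℕ; zero; suc; _+_; _∸_; _≤_; _<_; z≤n; s≤s; s≤s⁻¹; _<?_; _≤?_)
open import Data.Nat.ListAction using (sum)
open import Data.Nat.Properties
  using (1+n≢n; suc-injective; +-identityʳ; +-suc; +-comm; +-∸-assoc; m≤n+m; m+n∸n≡m; m∸n+n≡m;
         ≤-refl; ≤-reflexive; ≤-trans; ≤-antisym; <-trans; ≤-<-trans; <-≤-trans; <⇒≤; <⇒≱; ≮⇒≥; ≰⇒>;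
         +-monoˡ-<; +-cancelʳ-<; +-cancelʳ-≡)
open import Data.Product using (Σ; ∃; _×_; _,_; proj₁; proj₂)
open import Data.Product.Relation.Binary.Lex.Strict using (×-isStrictTotalOrder)
open import Data.Product.Relation.Binary.Pointwise.NonDependent using (Pointwise; ≡×≡⇒≡)
open import Data.Sum using (_⊎_; inj₁; inj₂; [_,_]′)
import Data.Vec as Vec
open import Data.Vec.Properties using (lookup∘tabulate; []=⇒lookup; lookup⇒[]=)
import Data.Vec.Properties as Vecₚ
open import Function using (_∘_; id; case_of_; _⇔_; mk⇔; Equivalence; Injective; Injection)
open import Function.Properties.Inverse using (↔⇒↣)
open import Induction.WellFounded using (Acc; acc)
open import Relation.Binary.Bundles using (TotalOrder)
import Relation.Binary.Construct.Flip.EqAndOrd as Flip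
import Relation.Binary.Construct.StrictToNonStrict as StrictToNonStrict
open import Relation.Binary.Definitions using (Decidable; tri<; tri≈; tri>)
open import Relation.Binary.PropositionalEquality
open import Relation.Binary.Structures using (IsStrictTotalOrder)
open import Relation.Nullary using (¬_; Dec; does; yes; no; contradiction)
open import Relation.Nullary.Decidable using (dec-true; _×-dec_)

-- The order ≺

-- _≺_ is definitionally the lexicographic product of the reversed orders on colours and values.
≺-isStrictTotalOrder : ∀ {M n} → IsStrictTotalOrder (Pointwise _≡_ _≡_) (_≺_ {M} {n})
≺-isStrictTotalOrder =
  ×-isStrictTotalOrder (Flip.isStrictTotalOrder Fin.<-isStrictTotalOrder)
                       (Flip.isStrictTotalOrder Fin.<-isStrictTotalOrder)

module _ {M n : ℕ} where
  private module ≺ = IsStrictTotalOrder (≺-isStrictTotalOrder {M} {n})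

  ≺-asym : {p q : Elem M n} → p ≺ q → ¬ q ≺ p
  ≺-asym = ≺.asym

  ≺-trans : {p q r : Elem M n} → p ≺ q → q ≺ r → p ≺ r
  ≺-trans = ≺.trans

  _≺?_ : Decidable (_≺_ {M} {n})
  _≺?_ = ≺._<?_

  ≢⇒≺⊎≻ : (p q : Elem M n) → p ≢ q → p ≺ q ⊎ q ≺ p
  ≢⇒≺⊎≻ p q p≢q with ≺.compare p q
  ... | tri< p≺q _ _ = inj₁ p≺q
  ... | tri≈ _ p≈q _ = ⊥-elim (p≢q (≡×≡⇒≡ p≈q))
  ... | tri> _ _ q≺p = inj₂ q≺p

_≼_ : ∀ {M n} → Elem M n → Elem M n → Set
p ≼ q = p ≺ q ⊎ p ≡ q

≼-totalOrder : ℕ → ℕ → TotalOrder _ _ _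
≼-totalOrder M n = record
  { isTotalOrder = StrictToNonStrict.isTotalOrder (Pointwise _≡_ _≡_) (_≺_ {M} {n}) ≺-isStrictTotalOrder }

maximum : ∀ {M n m} (f : Fin (suc m) → Elem M n) → ∃ λ g → ∀ j → f j ≼ f g
maximum {M} {n} {m} f = g , λ j → ≤⇒≼ (All.lookup (f[xs]≤f[argmax] {f = f} zero (allFin _)) (∈-allFin j))
  where
    open Extrema (≼-totalOrder M n) using (argmax; f[xs]≤f[argmax])
    g : Fin (suc m)
    g = argmax f zero (allFin _)
    ≤⇒≼ : ∀ {p q} → TotalOrder._≤_ (≼-totalOrder M n) p q → p ≼ q
    ≤⇒≼ (inj₁ p≺q) = inj₁ p≺q
    ≤⇒≼ (inj₂ p≈q) = inj₂ (≡×≡⇒≡ p≈q)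

≼⇒colour-≥ : ∀ {M n} {p q : Elem M n} → p ≼ q → toℕ (proj₁ q) ≤ toℕ (proj₁ p)
≼⇒colour-≥ (inj₁ (inj₁ b<a))        = <⇒≤ b<a
≼⇒colour-≥ (inj₁ (inj₂ (refl , _))) = ≤-refl
≼⇒colour-≥ (inj₂ refl)              = ≤-refl

-- Pinnacles of words

Word : ℕ → ℕ → Set
Word M n = Fin n → Elem M n

_⋖_ : ∀ {n} → Fin n → Fin n → Set
i ⋖ j = suc (toℕ i) ≡ toℕ j

⋖⇒≢ : ∀ {n} {i j : Fin n} → i ⋖ j → i ≢ j
⋖⇒≢ i⋖i refl = 1+n≢n i⋖i

-- InPin w is definitionally Pin (app w).
Pin : ∀ {M n} → Word M n → Elem M n → Set
Pin {n = n} f p =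
  Σ (Fin n) λ i⁻ → Σ (Fin n) λ i → Σ (Fin n) λ i⁺ →
    i⁻ ⋖ i × i ⋖ i⁺ × p ≡ f i × f i⁺ ≺ f i × f i⁻ ≺ f i

SamePins : ∀ {M n} → Word M n → Word M n → Set
SamePins f g = ∀ p → Pin f p ⇔ Pin g p

module _ {M n : ℕ} where
  Pin-cong : {f g : Word M n} → (∀ i → f i ≡ g i) → ∀ {p} → Pin f p → Pin g p
  Pin-cong f≗g (i⁻ , i , i⁺ , i⁻⋖i , i⋖i⁺ , p≡fi , fi⁺≺fi , fi⁻≺fi) =
    i⁻ , i , i⁺ , i⁻⋖i , i⋖i⁺ , trans p≡fi (f≗g i) ,
    subst₂ _≺_ (f≗g i⁺) (f≗g i) fi⁺≺fi , subst₂ _≺_ (f≗g i⁻) (f≗g i) fi⁻≺fi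

  Pin⇒letter : {f : Word M n} {p : Elem M n} → Pin f p → ∃ λ i → p ≡ f i
  Pin⇒letter (_ , i , _ , _ , _ , p≡fi , _) = i , p≡fi

  SamePins-refl : {f : Word M n} → SamePins f f
  SamePins-refl p = mk⇔ id id

  SamePins-trans : {f g h : Word M n} → SamePins f g → SamePins g h → SamePins f h
  SamePins-trans f∼g g∼h p = mk⇔ (to (g∼h p) ∘ to (f∼g p)) (from (f∼g p) ∘ from (g∼h p))
    where open Equivalence

  interior-maximum-isPin : {f : Word M n} → Injective _≡_ _≡_ f → {i⁻ i i⁺ : Fin n} → i⁻ ⋖ i → i ⋖ i⁺ →
    (∀ j → f j ≼ f i) → Pin f (f i)
  interior-maximum-isPin {f} f-injective {i⁻} {i} {i⁺} i⁻⋖i i⋖i⁺ max =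
    i⁻ , i , i⁺ , i⁻⋖i , i⋖i⁺ , refl , below i⁺ (≢-sym (⋖⇒≢ i⋖i⁺)) , below i⁻ (⋖⇒≢ i⁻⋖i)
    where
      below : ∀ j → j ≢ i → f j ≺ f i
      below j j≢i = [ id , ⊥-elim ∘ j≢i ∘ f-injective ]′ (max j)

  ⋖-opposite : {i j : Fin n} → i ⋖ j → opposite j ⋖ opposite i
  ⋖-opposite {i} {j} i⋖j = begin
    suc (toℕ (opposite j))  ≡⟨ cong suc (opposite-prop j) ⟩
    suc (n ∸ suc (toℕ j))   ≡⟨ +-∸-assoc 1 (toℕ<n j) ⟨
    n ∸ toℕ j               ≡⟨ cong (n ∸_) i⋖j ⟨
    n ∸ suc (toℕ i)         ≡⟨ opposite-prop i ⟨
    toℕ (opposite i)        ∎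
    where open ≡-Reasoning

  Pin-reverse : {f : Word M n} → SamePins f (f ∘ opposite)
  Pin-reverse {f} p = mk⇔ (unreverse ∘ Pin-cong (cong f ∘ sym ∘ opposite-involutive)) unreverse
    where
      unreverse : {g : Word M n} → Pin (g ∘ opposite) p → Pin g p
      unreverse (i⁻ , i , i⁺ , i⁻⋖i , i⋖i⁺ , p≡gi , gi⁺≺gi , gi⁻≺gi) =
        opposite i⁺ , opposite i , opposite i⁻ , ⋖-opposite i⋖i⁺ , ⋖-opposite i⁻⋖i , p≡gi , gi⁻≺gi , gi⁺≺gi

module _ {M N n : ℕ} (h : Elem M n → Elem N n)
         (h-≺ : ∀ {p q} → p ≺ q ⇔ h p ≺ h q) (h-injective : Injective _≡_ _≡_ h) where
  open Equivalence

  Pin-map : {f : Word M n} {p : Elem M n} → Pin (h ∘ f) (h p) ⇔ Pin f p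
  Pin-map = mk⇔
    (λ { (i⁻ , i , i⁺ , i⁻⋖i , i⋖i⁺ , hp≡hfi , ≺⁺ , ≺⁻) →
         i⁻ , i , i⁺ , i⁻⋖i , i⋖i⁺ , h-injective hp≡hfi , from h-≺ ≺⁺ , from h-≺ ≺⁻ })
    (λ { (i⁻ , i , i⁺ , i⁻⋖i , i⋖i⁺ , p≡fi , ≺⁺ , ≺⁻) →
         i⁻ , i , i⁺ , i⁻⋖i , i⋖i⁺ , cong h p≡fi , to h-≺ ≺⁺ , to h-≺ ≺⁻ })

DescendingUpTo : ∀ {M n} → Fin n → Word M n → Set
DescendingUpTo t f = ∀ {i j} → i ⋖ j → toℕ j ≤ toℕ t → f j ≺ f i

module _ {M n : ℕ} where
  -- A pin of f lies beyond t, where f and g agree, because f descends up to t; only its left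
  -- neighbour can sit at t, and there the junction hypothesis applies.
  Pin-transfer : {f g : Word M n} (t : Fin n) → (∀ {i} → toℕ t < toℕ i → f i ≡ g i) →
    DescendingUpTo t f → (∀ {j} → t ⋖ j → f t ≺ f j → g t ≺ g j) → ∀ {p} → Pin f p → Pin g p
  Pin-transfer {f} {g} t agree desc junction (i⁻ , i , i⁺ , i⁻⋖i , i⋖i⁺ , p≡fi , fi⁺≺fi , fi⁻≺fi)
    with toℕ t <? toℕ i
  ... | no  t≮i = ⊥-elim (≺-asym fi⁻≺fi (desc i⁻⋖i (≮⇒≥ t≮i)))
  ... | yes t<i =
    i⁻ , i , i⁺ , i⁻⋖i , i⋖i⁺ , trans p≡fi (agree t<i) ,
    subst₂ _≺_ (agree (<-trans t<i (≤-reflexive i⋖i⁺))) (agree t<i) fi⁺≺fi , gi⁻≺gi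
    where
      t≤i⁻ : toℕ t ≤ toℕ i⁻
      t≤i⁻ = s≤s⁻¹ (≤-trans t<i (≤-reflexive (sym i⁻⋖i)))
      gi⁻≺gi : g i⁻ ≺ g i
      gi⁻≺gi with toℕ t <? toℕ i⁻
      ... | yes t<i⁻ = subst₂ _≺_ (agree t<i⁻) (agree t<i) fi⁻≺fi
      ... | no  t≮i⁻ with toℕ-injective {i = i⁻} (≤-antisym (≮⇒≥ t≮i⁻) t≤i⁻)
      ...   | refl = junction i⁻⋖i fi⁻≺fi

  SamePins-of-descendingPrefix : {f g : Word M n} (t : Fin n) → (∀ {i} → toℕ t < toℕ i → f i ≡ g i) →
    DescendingUpTo t f → DescendingUpTo t g → (∀ {j} → t ⋖ j → f t ≺ f j ⇔ g t ≺ g j) → SamePins f g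
  SamePins-of-descendingPrefix t agree f-desc g-desc junction p =
    mk⇔ (Pin-transfer t agree f-desc (Equivalence.to ∘ junction))
        (Pin-transfer t (sym ∘ agree) g-desc (Equivalence.from ∘ junction))

-- Positions

module _ {n : ℕ} where
  zero-or-⋖ : (i : Fin (suc n)) → i ≡ zero ⊎ ∃ (_⋖ i)
  zero-or-⋖ zero    = inj₁ refl
  zero-or-⋖ (suc i) = inj₂ (inject₁ i , cong suc (toℕ-inject₁ i))

  successor-upTo : {i t : Fin n} → toℕ i < toℕ t → ∃ λ j → i ⋖ j × toℕ j ≤ toℕ t
  successor-upTo {i} {t} i<t = fromℕ< (≤-<-trans i<t (toℕ<n t)) , sym (toℕ-fromℕ< _) ,
    ≤-trans (≤-reflexive (toℕ-fromℕ< _)) i<t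

last-or-⋖ : ∀ {n} (i : Fin (suc n)) → i ≡ fromℕ n ⊎ ∃ (i ⋖_)
last-or-⋖ {zero}  zero    = inj₁ refl
last-or-⋖ {suc n} zero    = inj₂ (suc zero , refl)
last-or-⋖ {suc n} (suc i) with last-or-⋖ i
... | inj₁ i≡last      = inj₁ (cong suc i≡last)
... | inj₂ (j , i⋖j)   = inj₂ (suc j , cong suc i⋖j)

longestRun : ∀ {n} (R : Fin (suc n) → Fin (suc n) → Set) → Decidable R →
  ∃ λ t → (∀ {i j} → i ⋖ j → toℕ j ≤ toℕ t → R i j) × (∀ {j} → t ⋖ j → ¬ R t j)
longestRun {zero} R R? = zero , (λ { {j = zero} () _ }) , λ { {zero} () }
longestRun {suc n} R R? with R? zero (suc zero)
... | no ¬r = zero , (λ { {j = zero} () _ ; {j = suc _} _ () }) , stop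
  where
    stop : ∀ {j} → zero ⋖ j → ¬ R zero j
    stop {zero}        ()
    stop {suc zero}    refl = ¬r
    stop {suc (suc _)} ()
... | yes r with longestRun (λ i j → R (suc i) (suc j)) (λ i j → R? (suc i) (suc j))
...   | t , run , stop = suc t , run′ , stop′
  where
    run′ : ∀ {i j} → i ⋖ j → toℕ j ≤ toℕ (suc t) → R i j
    run′ {zero}  {suc zero}    refl _  = r
    run′ {suc i} {suc j}       i⋖j  j≤t = run (suc-injective i⋖j) (s≤s⁻¹ j≤t)
    run′ {_}     {zero}        ()   _
    run′ {zero}  {suc (suc _)} ()   _
    stop′ : ∀ {j} → suc t ⋖ j → ¬ R (suc t) j
    stop′ {suc j} t⋖j = stop (suc-injective t⋖j)
    stop′ {zero}  ()

rotate : ∀ {n} → Fin (suc n) → Permutation′ (suc n)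
rotate zero = Perm.id
rotate {suc n} (suc t) = lift₀ (rotate t) ∘ₚ transpose zero (suc zero)

rotate-self : ∀ {n} (t : Fin (suc n)) → rotate t ⟨$⟩ʳ t ≡ zero
rotate-self zero = refl
rotate-self {suc n} (suc t) rewrite rotate-self t = refl

rotate-⋖ : ∀ {n} (t : Fin (suc n)) {i j} → i ⋖ j → toℕ j ≤ toℕ t → rotate t ⟨$⟩ʳ i ≡ j
rotate-⋖ {suc n} (suc t) {zero}  {suc zero}    refl _ = refl
rotate-⋖ {suc n} (suc t) {suc i} {suc (suc j)} i⋖j j≤t
  rewrite rotate-⋖ t (suc-injective i⋖j) (s≤s⁻¹ j≤t) = refl

rotate-above : ∀ {n} (t : Fin (suc n)) {i} → toℕ t < toℕ i → rotate t ⟨$⟩ʳ i ≡ i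
rotate-above zero t<i = refl
rotate-above {suc n} (suc t) {suc (suc i)} t<i rewrite rotate-above t (s≤s⁻¹ t<i) = refl
rotate-above {suc n} (suc t) {suc zero} (s≤s ())

-- Raising colours by k

liftColour : ∀ {m} k → Fin m → Fin (m + k)
liftColour k a = fromℕ< (+-monoˡ-< k (toℕ<n a))

module _ {m : ℕ} (k : ℕ) where
  toℕ-liftColour : (a : Fin m) → toℕ (liftColour k a) ≡ toℕ a + k
  toℕ-liftColour a = toℕ-fromℕ< _

  liftColour-injective : Injective _≡_ _≡_ (liftColour {m} k)
  liftColour-injective {a} {a′} e = toℕ-injective (+-cancelʳ-≡ k _ _ (begin
    toℕ a + k                ≡⟨ toℕ-liftColour a ⟨
    toℕ (liftColour k a)     ≡⟨ cong toℕ e ⟩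
    toℕ (liftColour k a′)    ≡⟨ toℕ-liftColour a′ ⟩
    toℕ a′ + k               ∎))
    where open ≡-Reasoning

  liftColour-surjective : (b : Fin (m + k)) → k ≤ toℕ b → ∃ λ a → liftColour k a ≡ b
  liftColour-surjective b k≤b = a , toℕ-injective (begin
    toℕ (liftColour k a)     ≡⟨ toℕ-liftColour a ⟩
    toℕ a + k                ≡⟨ cong (_+ k) (toℕ-fromℕ< _) ⟩
    toℕ b ∸ k + k            ≡⟨ m∸n+n≡m k≤b ⟩
    toℕ b                    ∎)
    where
      open ≡-Reasoning
      a : Fin m
      a = fromℕ< (+-cancelʳ-< k (toℕ b ∸ k) m (subst (_< m + k) (sym (m∸n+n≡m k≤b)) (toℕ<n b)))

  liftColour-or-low : (b : Fin (m + k)) → (∃ λ a → liftColour k a ≡ b) ⊎ toℕ b < k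
  liftColour-or-low b with k ≤? toℕ b
  ... | yes k≤b = inj₁ (liftColour-surjective b k≤b)
  ... | no  k≰b = inj₂ (≰⇒> k≰b)

raise : ∀ {m n} k → Elem m n → Elem (m + k) n
raise k (a , x) = liftColour k a , x

module _ {m n : ℕ} (k : ℕ) where
  raise-injective : Injective _≡_ _≡_ (raise {m} {n} k)
  raise-injective {a , x} {a′ , x′} e = cong₂ _,_ (liftColour-injective k (cong proj₁ e)) (cong proj₂ e)

  raise-≺ : {p q : Elem m n} → p ≺ q ⇔ raise k p ≺ raise k q
  raise-≺ {a , x} {b , y} = mk⇔ to from
    where
      to : (a , x) ≺ (b , y) → raise k (a , x) ≺ raise k (b , y)
      to (inj₁ b<a)         =
        inj₁ (subst₂ _<_ (sym (toℕ-liftColour k b)) (sym (toℕ-liftColour k a)) (+-monoˡ-< k b<a))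
      to (inj₂ (refl , y<x)) = inj₂ (refl , y<x)
      from : raise k (a , x) ≺ raise k (b , y) → (a , x) ≺ (b , y)
      from (inj₁ b<a)      =
        inj₁ (+-cancelʳ-< k _ _ (subst₂ _<_ (toℕ-liftColour k b) (toℕ-liftColour k a) b<a))
      from (inj₂ (e , y<x)) = inj₂ (liftColour-injective k e , y<x)

module _ {m n : ℕ} (k : ℕ) (Q : SubsetI m n) where
  Ψ-hit : {a : Fin m} {b : Fin (m + k)} {x : Fin n} → toℕ b ≡ toℕ a + k → Ψ k Q (b , x) ≡ Q (a , x)
  Ψ-hit {a} {b} {x} b≡a+k with k ≤? toℕ b
  ... | no  k≰b = ⊥-elim (k≰b (subst (k ≤_) (sym b≡a+k) (m≤n+m k (toℕ a))))
  ... | yes _   = cong (λ a′ → Q (a′ , x)) (toℕ-injective (begin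
    toℕ (fromℕ< _)   ≡⟨ toℕ-fromℕ< _ ⟩
    toℕ b ∸ k        ≡⟨ cong (_∸ k) b≡a+k ⟩
    toℕ a + k ∸ k    ≡⟨ m+n∸n≡m (toℕ a) k ⟩
    toℕ a            ∎))
    where open ≡-Reasoning

  Ψ-raise : (p : Elem m n) → Ψ k Q (raise k p) ≡ Q p
  Ψ-raise (a , x) = Ψ-hit (toℕ-liftColour k a)

  Ψ-low : {b : Fin (m + k)} {x : Fin n} → toℕ b < k → Ψ k Q (b , x) ≡ false
  Ψ-low {b} b<k with k ≤? toℕ b
  ... | no  _   = refl
  ... | yes k≤b = ⊥-elim (<⇒≱ b<k k≤b)

  Ψ-high : {b : Fin (m + k)} {x : Fin n} → (b , x) ∈ˢ Ψ k Q → k ≤ toℕ b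
  Ψ-high {b} b∈ΨQ with k ≤? toℕ b
  ... | yes k≤b = k≤b
  ... | no  _   = contradiction b∈ΨQ λ ()

sum-map-zero : ∀ {A : Set} (xs : List A) → sum (map (λ _ → 0) xs) ≡ 0
sum-map-zero []       = refl
sum-map-zero (_ ∷ xs) = sum-map-zero xs

-- Stated for an arbitrary N with k + m ≡ N so that the induction on k type-checks.
sum-tabulate-shift : ∀ {N m} k (F : Fin N → ℕ) (G : Fin m → ℕ) → k + m ≡ N →
  (∀ b → toℕ b < k → F b ≡ 0) → (∀ a b → toℕ b ≡ toℕ a + k → F b ≡ G a) →
  sum (tabulate F) ≡ sum (tabulate G)
sum-tabulate-shift zero F G refl _ shifted =
  cong sum (tabulate-cong λ a → shifted a a (sym (+-identityʳ (toℕ a))))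
sum-tabulate-shift (suc k) F G refl low shifted =
  cong₂ _+_ (low zero (s≤s z≤n))
    (sum-tabulate-shift k (F ∘ suc) G refl (λ b b<k → low (suc b) (s≤s b<k))
      λ a b b≡a+k → shifted a (suc b) (trans (cong suc b≡a+k) (sym (+-suc (toℕ a) k))))

countTrue : ∀ {n} → (Fin n → Bool) → ℕ
countTrue {n} r = sum (map (λ x → if r x then 1 else 0) (allFin n))

countTrue-cong : ∀ {n} {r s : Fin n → Bool} → (∀ x → r x ≡ s x) → countTrue r ≡ countTrue s
countTrue-cong {n} r≗s = cong sum (map-cong (λ x → cong (λ b → if b then 1 else 0) (r≗s x)) (allFin n))

card-cong : ∀ {M n} {Q R : SubsetI M n} → Q ≐ R → card Q ≡ card R
card-cong {M} Q≐R = cong sum (map-cong (λ a → countTrue-cong (λ x → Q≐R (a , x))) (allFin M))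

card-Ψ : ∀ {m n} k (Q : SubsetI m n) → card (Ψ k Q) ≡ card Q
card-Ψ {m} {n} k Q = begin
  card (Ψ k Q)           ≡⟨ cong sum (map-tabulate id row′) ⟩
  sum (tabulate row′)    ≡⟨ sum-tabulate-shift k row′ row (+-comm k m) low shifted ⟩
  sum (tabulate row)     ≡⟨ cong sum (map-tabulate id row) ⟨
  card Q                 ∎
  where
    open ≡-Reasoning
    row′ : Fin (m + k) → ℕ
    row′ b = countTrue (λ x → Ψ k Q (b , x))
    row : Fin m → ℕ
    row a = countTrue (λ x → Q (a , x))
    low : ∀ b → toℕ b < k → row′ b ≡ 0
    low b b<k = trans (countTrue-cong (λ x → Ψ-low k Q {x = x} b<k)) (sum-map-zero (allFin n))
    shifted : ∀ a b → toℕ b ≡ toℕ a + k → row′ b ≡ row a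
    shifted a b b≡a+k = countTrue-cong (λ x → Ψ-hit k Q {x = x} b≡a+k)

-- Removing the letters of colour < k

-- ρ ∘ₚ σ applies ρ first, so app (relocate ρ w) i is app w (ρ ⟨$⟩ʳ i).
relocate : ∀ {M n} → Permutation′ n → Wreath M n → Wreath M n
relocate ρ (wreath σ c) = wreath (ρ ∘ₚ σ) (c ∘ (ρ ⟨$⟩ʳ_))

recolourFirst : ∀ {M n} → Fin M → Wreath M (suc n) → Wreath M (suc n)
recolourFirst a (wreath σ c) = wreath σ λ { zero → a ; (suc i) → c (suc i) }

colourOfValue : ∀ {M n} → Wreath M n → Fin n → Fin M
colourOfValue (wreath σ c) x = c (σ ⟨$⟩ˡ x)

app-injective : ∀ {M n} (w : Wreath M n) → Injective _≡_ _≡_ (app w)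
app-injective (wreath σ _) = Injection.injective (↔⇒↣ σ) ∘ cong proj₂

module _ {M n : ℕ} (ρ : Permutation′ n) (w : Wreath M n) where
  colourOfValue-relocate : ∀ x → colourOfValue (relocate ρ w) x ≡ colourOfValue w x
  colourOfValue-relocate x = cong (Wreath.colour w) (inverseʳ ρ)

module Normalisation {N : ℕ} (k : ℕ) (top : Fin N) (k≤top : k ≤ toℕ top) where
  Low : Fin N → Set
  Low a = toℕ a < k

  -- Low letters are recorded by their values, which relocation does not change.
  lowLetters : ∀ {n} → Wreath N n → Subset n
  lowLetters w = Vec.tabulate λ x → does (toℕ (colourOfValue w x) <? k)

  ∈-lowLetters : ∀ {n} (w : Wreath N n) {x} → x ∈ lowLetters w ⇔ Low (colourOfValue w x)
  ∈-lowLetters w {x} = mk⇔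
    (λ x∈ → witness (_ <? k) (trans (sym (lookup∘tabulate _ x)) ([]=⇒lookup x∈)))
    (λ low → lookup⇒[]= x _ (trans (lookup∘tabulate _ x) (dec-true (_ <? k) low)))
    where
      witness : ∀ {A : Set} (a? : Dec A) → does a? ≡ true → A
      witness (yes a) _ = a

  lowLetters-relocate : ∀ {n} (ρ : Permutation′ n) (w : Wreath N n) → lowLetters (relocate ρ w) ≡ lowLetters w
  lowLetters-relocate ρ w =
    Vecₚ.tabulate-cong λ x → cong (λ a → does (toℕ a <? k)) (colourOfValue-relocate ρ w x)

  lowLetters-recolourFirst : ∀ {n} (w : Wreath N (suc n)) → Low (Wreath.colour w zero) →
    lowLetters (recolourFirst top w) ⊂ lowLetters w
  lowLetters-recolourFirst w@(wreath σ c) first-low =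
    (λ x∈ → from (∈-lowLetters w) (unrecolour _ (to (∈-lowLetters w′) x∈))) ,
    σ ⟨$⟩ʳ zero ,
    from (∈-lowLetters w) (subst (Low ∘ c) (sym (inverseˡ σ)) first-low) ,
    λ x∈ → top-high (subst (Low ∘ Wreath.colour w′) (inverseˡ σ) (to (∈-lowLetters w′) x∈))
    where
      open Equivalence
      w′ : Wreath N _
      w′ = recolourFirst top w
      top-high : ¬ Low top
      top-high top<k = <⇒≱ top<k k≤top
      unrecolour : ∀ i → Low (Wreath.colour w′ i) → Low (c i)
      unrecolour zero    top<k = ⊥-elim (top-high top<k)
      unrecolour (suc i) low   = low

  FewerLowLetters : ∀ {n} → Wreath N n → Set
  FewerLowLetters {n} w = ∃ λ (w₁ : Wreath N n) → SamePins (app w) (app w₁) × lowLetters w₁ ⊂ lowLetters w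

  -- W moves the recoloured first letter E′ zero to position t, the end of the longest descending
  -- run E 0 ≻ E 1 ≻ ⋯ ≻ E t of letters lying above E′ zero.
  module _ {n : ℕ} (w : Wreath N (suc n)) (first-low : Low (Wreath.colour w zero)) where
    private
      E E′ : Word N (suc n)
      E  = app w
      E′ = app (recolourFirst top w)

      E′₀≺E₀ : E′ zero ≺ E zero
      E′₀≺E₀ = inj₁ (<-≤-trans first-low k≤top)

      Run : Fin (suc n) → Fin (suc n) → Set
      Run i j = E j ≺ E i × E′ zero ≺ E j

      longest : ∃ λ t → (∀ {i j} → i ⋖ j → toℕ j ≤ toℕ t → Run i j) × (∀ {j} → t ⋖ j → ¬ Run t j)
      longest = longestRun Run λ i j → (E j ≺? E i) ×-dec (E′ zero ≺? E j)

      t : Fin (suc n)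
      t = proj₁ longest

      run : ∀ {i j} → i ⋖ j → toℕ j ≤ toℕ t → Run i j
      run = proj₁ (proj₂ longest)

      stop : ∀ {j} → t ⋖ j → ¬ Run t j
      stop = proj₂ (proj₂ longest)

      E′₀≺Eₜ : E′ zero ≺ E t
      E′₀≺Eₜ with zero-or-⋖ t
      ... | inj₁ t≡0        = subst (λ i → E′ zero ≺ E i) (sym t≡0) E′₀≺E₀
      ... | inj₂ (_ , t⁻⋖t) = proj₂ (run t⁻⋖t ≤-refl)

      w₁ : Wreath N (suc n)
      w₁ = relocate (rotate t) (recolourFirst top w)

      W : Word N (suc n)
      W = app w₁

      W-above : ∀ {i} → toℕ t < toℕ i → E i ≡ W i
      W-above {suc i} t<i = sym (cong E′ (rotate-above t t<i))

      W-⋖ : ∀ {i j} → i ⋖ j → toℕ j ≤ toℕ t → W i ≡ E j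
      W-⋖ {j = suc j} i⋖j j≤t = cong E′ (rotate-⋖ t i⋖j j≤t)

      W-t : W t ≡ E′ zero
      W-t = cong E′ (rotate-self t)

      E-desc : DescendingUpTo t E
      E-desc i⋖j j≤t = proj₁ (run i⋖j j≤t)

      W-desc : DescendingUpTo t W
      W-desc {i} {j} i⋖j j≤t with toℕ j <? toℕ t
      ... | yes j<t = let (j⁺ , j⋖j⁺ , j⁺≤t) = successor-upTo j<t in
        subst₂ _≺_ (sym (W-⋖ j⋖j⁺ j⁺≤t)) (sym (W-⋖ i⋖j j≤t)) (E-desc j⋖j⁺ j⁺≤t)
      ... | no  j≮t with toℕ-injective {i = j} {j = t} (≤-antisym j≤t (≮⇒≥ j≮t))
      ...   | refl = subst₂ _≺_ (sym W-t) (sym (W-⋖ i⋖j j≤t)) E′₀≺Eₜ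

      junction : ∀ {j} → t ⋖ j → E t ≺ E j ⇔ W t ≺ W j
      junction {j} t⋖j = subst₂ (λ a b → E t ≺ E j ⇔ a ≺ b) (sym W-t) (W-above (≤-reflexive t⋖j)) (mk⇔
        (≺-trans E′₀≺Eₜ)
        λ E′₀≺Eⱼ → case ≢⇒≺⊎≻ (E t) (E j) (⋖⇒≢ t⋖j ∘ app-injective w) of λ where
          (inj₁ Eₜ≺Eⱼ) → Eₜ≺Eⱼ
          (inj₂ Eⱼ≺Eₜ) → ⊥-elim (stop t⋖j (Eⱼ≺Eₜ , E′₀≺Eⱼ)))

    fewerLowLetters-firstLow : FewerLowLetters w
    fewerLowLetters-firstLow =
      w₁ ,
      SamePins-of-descendingPrefix t W-above E-desc W-desc junction ,
      subst (_⊂ lowLetters w) (sym (lowLetters-relocate (rotate t) (recolourFirst top w)))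
        (lowLetters-recolourFirst w first-low)

  HighPins : ∀ {n} → Wreath N n → Set
  HighPins w = ∀ {p} → Pin (app w) p → k ≤ toℕ (proj₁ p)

  fewerLowLetters-reverse : ∀ {n} (w : Wreath N n) → FewerLowLetters (relocate Perm.reverse w) → FewerLowLetters w
  fewerLowLetters-reverse w (w₁ , same , fewer) =
    w₁ , SamePins-trans Pin-reverse same , subst (lowLetters w₁ ⊂_) (lowLetters-relocate Perm.reverse w) fewer

  fewerLowLetters-atMaximum : ∀ {n} (w : Wreath N (suc n)) → HighPins w →
    ∀ {g} → (∀ j → app w j ≼ app w g) → Low (Wreath.colour w g) → FewerLowLetters w
  fewerLowLetters-atMaximum w high {g} max g-low with zero-or-⋖ g | last-or-⋖ g
  ... | inj₁ refl | _ = fewerLowLetters-firstLow w g-low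
  ... | inj₂ (_ , g⁻⋖g) | inj₂ (_ , g⋖g⁺) =
    ⊥-elim (<⇒≱ g-low (high (interior-maximum-isPin (app-injective w) g⁻⋖g g⋖g⁺ max)))
  ... | inj₂ _ | inj₁ refl =
    fewerLowLetters-reverse w (fewerLowLetters-firstLow (relocate Perm.reverse w) g-low)

  fewerLowLetters : ∀ {n} (w : Wreath N n) → HighPins w → ∀ l → Low (Wreath.colour w l) → FewerLowLetters w
  fewerLowLetters {suc n} w high l l-low =
    let (g , max) = maximum (app w)
    in fewerLowLetters-atMaximum w high max (≤-<-trans (≼⇒colour-≥ (max l)) l-low)

  AllHigh : ∀ {n} → Wreath N n → Set
  AllHigh w = ∀ i → k ≤ toℕ (Wreath.colour w i)

  normalise : ∀ {n} (w : Wreath N n) → HighPins w → ∃ λ w″ → SamePins (app w) (app w″) × AllHigh w″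
  normalise w high = go w high (⊂-wellFounded (lowLetters w))
    where
      go : ∀ {n} (w : Wreath N n) → HighPins w → Acc _⊂_ (lowLetters w) →
           ∃ λ w″ → SamePins (app w) (app w″) × AllHigh w″
      go w high (acc smaller) with any? (λ i → toℕ (Wreath.colour w i) <? k)
      ... | no  none       = w , SamePins-refl , λ i → ≮⇒≥ (none ∘ (i ,_))
      ... | yes (l , l-low) with fewerLowLetters w high l l-low
      ...   | w₁ , same , fewer with go w₁ (high ∘ Equivalence.from (same _)) (smaller fewer)
      ...     | w″ , same′ , all-high = w″ , SamePins-trans same same′ , all-high

-- Pinnacle sets under Ψ_k

IsPinSet : ∀ {M n} → Wreath M n → SubsetI M n → Set
IsPinSet w Q = ∀ p → (p ∈ˢ Q → InPin w p) × (InPin w p → p ∈ˢ Q)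

IsPinSet-samePins : ∀ {M n} (w w′ : Wreath M n) {Q : SubsetI M n} →
  SamePins (app w) (app w′) → IsPinSet w Q → IsPinSet w′ Q
IsPinSet-samePins _ _ same Q-pins q = to (same q) ∘ proj₁ (Q-pins q) , proj₂ (Q-pins q) ∘ from (same q)
  where open Equivalence

HighLetters : ∀ {m n} k → SubsetI (m + k) n → Set
HighLetters k Q′ = ∀ b x → (b , x) ∈ˢ Q′ → k ≤ toℕ b

Ψ-restrict : ∀ {m n} k (Q′ : SubsetI (m + k) n) → HighLetters k Q′ → Q′ ≐ Ψ k (Q′ ∘ raise k)
Ψ-restrict k Q′ high (b , x) with liftColour-or-low k b
... | inj₁ (a , refl) = sym (Ψ-raise k (Q′ ∘ raise k) (a , x))
... | inj₂ b<k        = trans (¬-not (<⇒≱ b<k ∘ high b x)) (sym (Ψ-low k (Q′ ∘ raise k) b<k))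

module _ {m n : ℕ} (k : ℕ) (w : Wreath m n) (w′ : Wreath (m + k) n) (w′≗ : ∀ i → app w′ i ≡ raise k (app w i))
         {Q : SubsetI m n} {Q′ : SubsetI (m + k) n} (Q′∘raise : ∀ p → Q′ (raise k p) ≡ Q p)
         (Q′-high : HighLetters k Q′) where
  open Equivalence

  IsPinSet-raise : IsPinSet w Q ⇔ IsPinSet w′ Q′
  IsPinSet-raise = mk⇔ (λ Q-pins q → member⇒pin Q-pins , pin⇒member Q-pins) lower-pins
    where
      pin-raise : ∀ {p} → InPin w′ (raise k p) ⇔ InPin w p
      pin-raise = mk⇔ (to (Pin-map (raise k) (raise-≺ k) (raise-injective k)) ∘ Pin-cong w′≗)
                      (Pin-cong (sym ∘ w′≗) ∘ from (Pin-map (raise k) (raise-≺ k) (raise-injective k)))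

      mem-raise : ∀ {p} → raise k p ∈ˢ Q′ ⇔ p ∈ˢ Q
      mem-raise {p} = mk⇔ (trans (sym (Q′∘raise p))) (trans (Q′∘raise p))

      member⇒pin : IsPinSet w Q → ∀ {q} → q ∈ˢ Q′ → InPin w′ q
      member⇒pin Q-pins {b , x} b∈Q′ with liftColour-surjective k b (Q′-high b x b∈Q′)
      ... | a , refl = from pin-raise (proj₁ (Q-pins (a , x)) (to mem-raise b∈Q′))

      raised-pin : ∀ {q} → InPin w′ q → ∃ λ p → raise k p ≡ q
      raised-pin q-pin = let (i , q≡w′i) = Pin⇒letter q-pin in app w i , sym (trans q≡w′i (w′≗ i))

      pin⇒member : IsPinSet w Q → ∀ {q} → InPin w′ q → q ∈ˢ Q′
      pin⇒member Q-pins q-pin with raised-pin q-pin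
      ... | p , refl = from mem-raise (proj₂ (Q-pins p) (to pin-raise q-pin))

      lower-pins : IsPinSet w′ Q′ → IsPinSet w Q
      lower-pins Q′-pins p = to pin-raise ∘ proj₁ (Q′-pins (raise k p)) ∘ from mem-raise
                           , to mem-raise ∘ proj₂ (Q′-pins (raise k p)) ∘ from pin-raise

liftColours : ∀ {m n} k → Wreath m n → Wreath (m + k) n
liftColours k (wreath σ c) = wreath σ (liftColour k ∘ c)

lowerColours : ∀ {m n} k (w : Wreath (m + k) n) → (∀ i → k ≤ toℕ (Wreath.colour w i)) → Wreath m n
lowerColours k w high = wreath (Wreath.perm w) (λ i → proj₁ (liftColour-surjective k _ (high i)))

raise-lowerColours : ∀ {m n} k (w : Wreath (m + k) n) (high : ∀ i → k ≤ toℕ (Wreath.colour w i)) →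
  ∀ i → app w i ≡ raise k (app (lowerColours k w high) i)
raise-lowerColours k w high i = cong (_, _) (sym (proj₂ (liftColour-surjective k _ (high i))))

Ψ-image⊆ : ∀ {m n} k d (Q′ : SubsetI (m + k) n) → (Σ (SubsetI m n) λ Q → InAPS d m n Q × (Q′ ≐ Ψ k Q)) →
  InAPS d (m + k) n Q′ × HighLetters k Q′
Ψ-image⊆ k d Q′ (Q , ((w , Q-pins) , card≤d) , Q′≐ΨQ) =
  ((liftColours k w , Equivalence.to (IsPinSet-raise k w (liftColours k w) (λ _ → refl) Q′∘raise high) Q-pins) ,
   subst (_≤ d) (sym (trans (card-cong Q′≐ΨQ) (card-Ψ k Q))) card≤d) ,
  high
  where
    Q′∘raise : ∀ p → Q′ (raise k p) ≡ Q p
    Q′∘raise p = trans (Q′≐ΨQ (raise k p)) (Ψ-raise k Q p)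
    high : HighLetters k Q′
    high b x b∈Q′ = Ψ-high k Q (trans (sym (Q′≐ΨQ (b , x))) b∈Q′)

Ψ-preimage : ∀ {m n} k d (Q′ : SubsetI (m + k) n) → HighLetters k Q′ → card Q′ ≤ d →
  (w″ : Wreath (m + k) n) → IsPinSet w″ Q′ → (∀ i → k ≤ toℕ (Wreath.colour w″ i)) →
  Σ (SubsetI m n) λ Q → InAPS d m n Q × (Q′ ≐ Ψ k Q)
Ψ-preimage {m} {n} k d Q′ high card≤d w″ Q′-pins all-high =
  Q′ ∘ raise k ,
  ((w , Equivalence.from (IsPinSet-raise k w w″ (raise-lowerColours k w″ all-high) (λ _ → refl) high) Q′-pins) ,
   subst (_≤ d) (trans (card-cong Q′≐ΨQ) (card-Ψ k (Q′ ∘ raise k))) card≤d) ,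
  Q′≐ΨQ
  where
    w : Wreath m n
    w = lowerColours k w″ all-high
    Q′≐ΨQ : Q′ ≐ Ψ k (Q′ ∘ raise k)
    Q′≐ΨQ = Ψ-restrict k Q′ high

⊆Ψ-image : ∀ {m n} k d (Q′ : SubsetI (suc m + k) n) → InAPS d (suc m + k) n Q′ × HighLetters k Q′ →
  Σ (SubsetI (suc m) n) λ Q → InAPS d (suc m) n Q × (Q′ ≐ Ψ k Q)
⊆Ψ-image k d Q′ (((w′ , Q′-pins) , card≤d) , high)
  with Normalisation.normalise k (liftColour k zero) (≤-reflexive (sym (toℕ-liftColour k zero)))
                               w′ (high _ _ ∘ proj₂ (Q′-pins _))
... | w″ , same , all-high = Ψ-preimage k d Q′ high card≤d w″ (IsPinSet-samePins w′ w″ same Q′-pins) all-high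

-- 1 ≤ m supplies a colour k in Fin (m + k) to recolour with.
mainTheorem13 : (m n k d : ℕ) → 1 ≤ m → 1 ≤ n → (Q′ : SubsetI (m + k) n) →
    ((Σ (SubsetI m n) λ Q → InAPS d m n Q × (Q′ ≐ Ψ k Q))
      → (InAPS d (m + k) n Q′ × (∀ b x → (b , x) ∈ˢ Q′ → k ≤ toℕ b)))
    × ((InAPS d (m + k) n Q′ × (∀ b x → (b , x) ∈ˢ Q′ → k ≤ toℕ b))
      → (Σ (SubsetI m n) λ Q → InAPS d m n Q × (Q′ ≐ Ψ k Q)))
mainTheorem13 (suc m) n k d (s≤s z≤n) _ Q′ = Ψ-image⊆ k d Q′ , ⊆Ψ-image k d Q′
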